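{- Let $\ell$ be an additive generalized length function and $h:2^{<\omega}\to2^{<\omega}$ a computable function. Then there is a constant $c$ such that for all $\sigma$, $K^{(\ell)}(h(\sigma))\leq K^{(\ell)}(\sigma)+c$.
   Context: A generalized length function is a computable $\ell:2^{<\omega}\to\omega$ with $\ell(\epsilon)=0$ and $\ell(\sigma)<\ell(\tau)$ whenever $\sigma$ is a proper initial segment of $\tau$; it is additive if $\ell(\sigma\tau)=\ell(\sigma)+\ell(\tau)$ for all strings. Fix a computable listing $(M_e)$ of all prefix-free machines and the universal prefix-free machine $U(0^e1\sigma)=M_e(\sigma)$; $K^{(\ell)}(\sigma)=\min\{\ell(\tau):U(\tau)\downarrow=\sigma\}$. -}

module Defs where

open import Data.Nat using (ℕ; zero; suc; _+_; _*_; _≤_)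
open import Data.Bool using (Bool; true; false)
open import Data.List using (List; []; _∷_; _++_; replicate)
open import Data.Product using (_×_; _,_; proj₁; proj₂; ∃; ∃-syntax; Σ)
open import Relation.Binary.PropositionalEquality using (_≡_)
open import Relation.Nullary using (¬_)

-- Binary strings 2^{<ω}:  List Bool, with  false = 0,  true = 1.

Str : Set
Str = List Bool

_⊑_ : Str → Str → Set
σ ⊑ τ = ∃[ ρ ] (σ ++ ρ ≡ τ)

_⊏_ : Str → Str → Set
σ ⊏ τ = σ ⊑ τ × ¬ (σ ≡ τ)

tri : ℕ → ℕ
tri zero    = zero
tri (suc n) = tri n + suc n

⟪_,_⟫ : ℕ → ℕ → ℕ
⟪ a , b ⟫ = tri (a + b) + b

-- inverse of the pairing function, by walking along the diagonals
unpair : ℕ → ℕ × ℕ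
unpair zero = zero , zero
unpair (suc n) with unpair n
... | zero  , b = suc b , zero
... | suc a , b = a , suc b

-- Bijective binary coding of strings as naturals

enc : Str → ℕ
enc []          = zero
enc (false ∷ s) = suc (2 * enc s)
enc (true  ∷ s) = suc (suc (2 * enc s))

-- Partial recursive functions ℕ ⇀ ℕ (codes as in Mathlib's Nat.Partrec.Code,
-- with plain unbounded minimisation), and their big-step semantics.

data Code : Set where
  zeroᶜ  : Code
  succᶜ  : Code
  leftᶜ  : Code
  rightᶜ : Code
  pairᶜ  : Code → Code → Code
  compᶜ  : Code → Code → Code
  precᶜ  : Code → Code → Code
  rfindᶜ : Code → Code

mutual
  data Eval : Code → ℕ → ℕ → Set where
    ev-zero  : ∀ {x} → Eval zeroᶜ x zero
    ev-succ  : ∀ {x} → Eval succᶜ x (suc x)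
    ev-left  : ∀ {x} → Eval leftᶜ x (proj₁ (unpair x))
    ev-right : ∀ {x} → Eval rightᶜ x (proj₂ (unpair x))
    ev-pair  : ∀ {f g x a b} → Eval f x a → Eval g x b → Eval (pairᶜ f g) x ⟪ a , b ⟫
    ev-comp  : ∀ {f g x y z} → Eval g x y → Eval f y z → Eval (compᶜ f g) x z
    -- primitive recursion on the second component of x = ⟪ a , n ⟫
    ev-prec0 : ∀ {f g x a y} → unpair x ≡ (a , zero) → Eval f a y → Eval (precᶜ f g) x y
    ev-precS : ∀ {f g x a n r y} → unpair x ≡ (a , suc n) →
               Eval (precᶜ f g) ⟪ a , n ⟫ r → Eval g ⟪ a , ⟪ n , r ⟫ ⟫ y →
               Eval (precᶜ f g) x y
    -- μ-operator: least n with f ⟪ x , n ⟫ = 0 (all earlier values defined, nonzero)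
    ev-rfind : ∀ {f x r} → Search f x zero r → Eval (rfindᶜ f) x r

  data Search (f : Code) (x : ℕ) : ℕ → ℕ → Set where
    found : ∀ {n} → Eval f ⟪ x , n ⟫ zero → Search f x n n
    next  : ∀ {n k r} → Eval f ⟪ x , n ⟫ (suc k) → Search f x (suc n) r → Search f x n r

Run : Code → Str → Str → Set
Run c σ τ = Eval c (enc σ) (enc τ)

ComputableStr : (Str → Str) → Set
ComputableStr h = ∃[ c ] (∀ σ → Run c σ (h σ))

ComputableStrℕ : (Str → ℕ) → Set
ComputableStrℕ f = ∃[ c ] (∀ σ → Eval c (enc σ) (f σ))

PrefixFree : Code → Set
PrefixFree c = ∀ σ τ y z → Run c σ y → Run c τ z → ¬ (σ ⊏ τ)

record PFListing (M : ℕ → Code) : Set where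
  field
    allPF      : ∀ e → PrefixFree (M e)
    complete   : ∀ c → PrefixFree c → ∃[ e ] (∀ σ τ → (Run (M e) σ τ → Run c σ τ) × (Run c σ τ → Run (M e) σ τ))
    uniform    : ∃[ u ] (∀ e σ τ → (Eval u ⟪ e , enc σ ⟫ (enc τ) → Run (M e) σ τ) × (Run (M e) σ τ → Eval u ⟪ e , enc σ ⟫ (enc τ)))

URun : (ℕ → Code) → Str → Str → Set
URun M τ σ = ∃[ e ] ∃[ ρ ] (τ ≡ replicate e false ++ (true ∷ ρ)) × Run (M e) ρ σ

record GenLength (ℓ : Str → ℕ) : Set where
  field
    computable : ComputableStrℕ ℓ
    empty      : ℓ [] ≡ zero
    strictMono : ∀ σ τ → σ ⊏ τ → suc (ℓ σ) ≤ ℓ τ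

Additive : (Str → ℕ) → Set
Additive ℓ = ∀ σ τ → ℓ (σ ++ τ) ≡ ℓ σ + ℓ τ

IsK : (ℕ → Code) → (Str → ℕ) → Str → ℕ → Set
IsK M ℓ σ n = (∃[ τ ] (URun M τ σ × ℓ τ ≡ n)) × (∀ τ → URun M τ σ → n ≤ ℓ τ)

-- The machine C(τ) = h(U(τ)) has the same domain as U, hence is prefix-free, and it is
-- partial computable: find e and ρ with τ = 0^e 1 ρ by unbounded search, run the uniform
-- simulation of M_e on ρ, then apply h. So C = M_e for some e, i.e. U(0^e 1 τ) = h(U(τ)).
-- A shortest U-description τ of σ therefore yields the U-description 0^e 1 τ of h(σ), and
-- by additivity ℓ(0^e 1 τ) = ℓ(τ) + ℓ(0^e 1); the constant is c = ℓ(0^e 1).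
module Submission where

open import Defs
open import Data.Nat using (ℕ; zero; suc; _+_; _*_; _≤_; _∸_; pred)
open import Data.Nat.Properties
open import Data.Bool using (false; true)
open import Data.List using ([]; _∷_; _++_; replicate)
open import Data.List.Properties using (++-assoc; ∷-injectiveʳ)
open import Data.Product using (_×_; _,_; proj₁; proj₂; ∃-syntax; ∃₂; map₂; uncurry)
open import Function using (_∘_)
open import Relation.Binary.PropositionalEquality
open import Relation.Nullary using (¬_; contradiction)

⟪1+a,0⟫≡1+⟪0,a⟫ : ∀ a → ⟪ suc a , zero ⟫ ≡ suc ⟪ zero , a ⟫
⟪1+a,0⟫≡1+⟪0,a⟫ a rewrite +-identityʳ a | +-identityʳ (tri a + suc a) = +-suc (tri a) a

⟪a,1+b⟫≡1+⟪1+a,b⟫ : ∀ a b → ⟪ a , suc b ⟫ ≡ suc ⟪ suc a , b ⟫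
⟪a,1+b⟫≡1+⟪1+a,b⟫ a b rewrite +-suc a b = +-suc (tri (suc (a + b))) b

unpair-⟪⟫ : ∀ a b → unpair ⟪ a , b ⟫ ≡ (a , b)
unpair-⟪⟫ a b = along-diagonal a b (diagonal-end (a + b))
  where
  DiagonalEnd : ℕ → Set
  DiagonalEnd d = unpair ⟪ d , zero ⟫ ≡ (d , zero)

  along-diagonal : ∀ i j → DiagonalEnd (i + j) → unpair ⟪ i , j ⟫ ≡ (i , j)
  along-diagonal i zero    end = subst DiagonalEnd (+-identityʳ i) end
  along-diagonal i (suc j) end
    rewrite ⟪a,1+b⟫≡1+⟪1+a,b⟫ i j | along-diagonal (suc i) j (subst DiagonalEnd (+-suc i j) end)
    = refl

  diagonal-end : ∀ d → DiagonalEnd d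
  diagonal-end zero    = refl
  diagonal-end (suc d) rewrite ⟪1+a,0⟫≡1+⟪0,a⟫ d | along-diagonal zero d (diagonal-end d) = refl

⟪⟫-unpair : ∀ n → uncurry ⟪_,_⟫ (unpair n) ≡ n
⟪⟫-unpair zero = refl
⟪⟫-unpair (suc n) with unpair n | ⟪⟫-unpair n
... | zero  , b | eq = trans (⟪1+a,0⟫≡1+⟪0,a⟫ b) (cong suc eq)
... | suc a , b | eq = trans (⟪a,1+b⟫≡1+⟪1+a,b⟫ a b) (cong suc eq)

mutual
  Eval-deterministic : ∀ {c x y y′} → Eval c x y → Eval c x y′ → y ≡ y′
  Eval-deterministic ev-zero  ev-zero  = refl
  Eval-deterministic ev-succ  ev-succ  = refl
  Eval-deterministic ev-left  ev-left  = refl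
  Eval-deterministic ev-right ev-right = refl
  Eval-deterministic (ev-pair f₁ g₁) (ev-pair f₂ g₂) =
    cong₂ ⟪_,_⟫ (Eval-deterministic f₁ f₂) (Eval-deterministic g₁ g₂)
  Eval-deterministic (ev-comp g₁ f₁) (ev-comp g₂ f₂) with Eval-deterministic g₁ g₂
  ... | refl = Eval-deterministic f₁ f₂
  Eval-deterministic (ev-prec0 p₁ f₁) (ev-prec0 p₂ f₂) with trans (sym p₁) p₂
  ... | refl = Eval-deterministic f₁ f₂
  Eval-deterministic (ev-prec0 p₁ _) (ev-precS p₂ _ _) with trans (sym p₁) p₂
  ... | ()
  Eval-deterministic (ev-precS p₁ _ _) (ev-prec0 p₂ _) with trans (sym p₁) p₂
  ... | ()
  Eval-deterministic (ev-precS p₁ r₁ g₁) (ev-precS p₂ r₂ g₂) with trans (sym p₁) p₂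
  ... | refl with Eval-deterministic r₁ r₂
  ...   | refl = Eval-deterministic g₁ g₂
  Eval-deterministic (ev-rfind s₁) (ev-rfind s₂) = Search-deterministic s₁ s₂

  Search-deterministic : ∀ {f x n r r′} → Search f x n r → Search f x n r′ → r ≡ r′
  Search-deterministic (found _) (found _) = refl
  Search-deterministic (found e₁) (next e₂ _) with Eval-deterministic e₁ e₂
  ... | ()
  Search-deterministic (next e₁ _) (found e₂) with Eval-deterministic e₁ e₂
  ... | ()
  Search-deterministic (next _ s₁) (next _ s₂) = Search-deterministic s₁ s₂

Search⇒root : ∀ {f x n r} → Search f x n r → Eval f ⟪ x , r ⟫ zero
Search⇒root (found e)  = e
Search⇒root (next _ s) = Search⇒root s

search-terminates : ∀ {f x} N → (∀ n → ∃[ v ] Eval f ⟪ x , n ⟫ v) →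
                    Eval f ⟪ x , N ⟫ zero → ∃[ r ] Search f x zero r
search-terminates {f} {x} N total root = search N zero refl
  where
  search : ∀ k n → n + k ≡ N → ∃[ r ] Search f x n r
  search zero n n+0≡N =
    n , found (subst (λ m → Eval f ⟪ x , m ⟫ zero) (trans (sym n+0≡N) (+-identityʳ n)) root)
  search (suc k) n n+1+k≡N with total n
  ... | zero  , n-root    = n , found n-root
  ... | suc _ , n-nonroot = map₂ (next n-nonroot) (search k (suc n) (trans (sym (+-suc n k)) n+1+k≡N))

eval-left : ∀ a b → Eval leftᶜ ⟪ a , b ⟫ a
eval-left a b = subst (Eval leftᶜ ⟪ a , b ⟫) (cong proj₁ (unpair-⟪⟫ a b)) ev-left

eval-right : ∀ a b → Eval rightᶜ ⟪ a , b ⟫ b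
eval-right a b = subst (Eval rightᶜ ⟪ a , b ⟫) (cong proj₂ (unpair-⟪⟫ a b)) ev-right

idᶜ : Code
idᶜ = pairᶜ leftᶜ rightᶜ

eval-id : ∀ x → Eval idᶜ x x
eval-id x = subst (Eval idᶜ x) (⟪⟫-unpair x) (ev-pair ev-left ev-right)

swapᶜ : Code
swapᶜ = pairᶜ rightᶜ leftᶜ

eval-swap : ∀ a b → Eval swapᶜ ⟪ a , b ⟫ ⟪ b , a ⟫
eval-swap a b = ev-pair (eval-right a b) (eval-left a b)

predᶜ : Code
predᶜ = compᶜ (precᶜ zeroᶜ (compᶜ leftᶜ rightᶜ)) (pairᶜ zeroᶜ idᶜ)

eval-pred : ∀ n → Eval predᶜ n (pred n)
eval-pred n = ev-comp (ev-pair ev-zero (eval-id n)) (pred-of-second n)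
  where
  pred-of-second : ∀ m → Eval (precᶜ zeroᶜ (compᶜ leftᶜ rightᶜ)) ⟪ zero , m ⟫ (pred m)
  pred-of-second zero    = ev-prec0 (unpair-⟪⟫ zero zero) ev-zero
  pred-of-second (suc m) = ev-precS (unpair-⟪⟫ zero (suc m)) (pred-of-second m)
    (ev-comp (eval-right zero ⟪ m , pred m ⟫) (eval-left m (pred m)))

-- `iterᶜ f g` maps ⟪ a , n ⟫ to gⁿ (f a): the step of `precᶜ` receives ⟪ a , ⟪ n , acc ⟫ ⟫
-- and g is applied to acc.
iterᶜ : Code → Code → Code
iterᶜ f g = precᶜ f (compᶜ g (compᶜ rightᶜ rightᶜ))

eval-iter : ∀ {f g} (R : ℕ → ℕ → ℕ) → (∀ a → Eval f a (R a zero)) →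
            (∀ a n → Eval g (R a n) (R a (suc n))) → ∀ a n → Eval (iterᶜ f g) ⟪ a , n ⟫ (R a n)
eval-iter R base step a zero    = ev-prec0 (unpair-⟪⟫ a zero) (base a)
eval-iter R base step a (suc n) = ev-precS (unpair-⟪⟫ a (suc n)) (eval-iter R base step a n)
  (ev-comp (ev-comp (eval-right a ⟪ n , R a n ⟫) (eval-right n (R a n))) (step a n))

monusᶜ : Code
monusᶜ = iterᶜ idᶜ predᶜ

eval-monus : ∀ a n → Eval monusᶜ ⟪ a , n ⟫ (a ∸ n)
eval-monus = eval-iter _∸_ eval-id
  (λ a n → subst (Eval predᶜ (a ∸ n)) (pred[m∸n]≡m∸[1+n] a n) (eval-pred (a ∸ n)))

plusᶜ : Code
plusᶜ = iterᶜ idᶜ succᶜ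

eval-plus : ∀ a n → Eval plusᶜ ⟪ a , n ⟫ (a + n)
eval-plus = eval-iter _+_
  (λ a → subst (Eval idᶜ a) (sym (+-identityʳ a)) (eval-id a))
  (λ a n → subst (Eval succᶜ (a + n)) (sym (+-suc a n)) ev-succ)

doubleᶜ : Code
doubleᶜ = compᶜ plusᶜ (pairᶜ idᶜ idᶜ)

eval-double : ∀ y → Eval doubleᶜ y (2 * y)
eval-double y = subst (Eval doubleᶜ y) (cong (y +_) (sym (+-identityʳ y)))
  (ev-comp (ev-pair (eval-id y) (eval-id y)) (eval-plus y y))

dist : ℕ → ℕ → ℕ
dist a b = (a ∸ b) + (b ∸ a)

dist≡0⇒≡ : ∀ {a b} → dist a b ≡ zero → a ≡ b
dist≡0⇒≡ {a} {b} eq =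
  ≤-antisym (m∸n≡0⇒m≤n {a} {b} (m+n≡0⇒m≡0 (a ∸ b) eq)) (m∸n≡0⇒m≤n {b} {a} (m+n≡0⇒n≡0 (a ∸ b) eq))

≡⇒dist≡0 : ∀ {a b} → a ≡ b → dist a b ≡ zero
≡⇒dist≡0 {a} refl = cong₂ _+_ (n∸n≡0 a) (n∸n≡0 a)

distᶜ : Code
distᶜ = compᶜ plusᶜ (pairᶜ monusᶜ (compᶜ monusᶜ swapᶜ))

eval-dist : ∀ a b → Eval distᶜ ⟪ a , b ⟫ (dist a b)
eval-dist a b =
  ev-comp (ev-pair (eval-monus a b) (ev-comp (eval-swap a b) (eval-monus b a))) (eval-plus (a ∸ b) (b ∸ a))

enc-injective : ∀ {s t} → enc s ≡ enc t → s ≡ t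
enc-injective {[]}        {[]}        _  = refl
enc-injective {[]}        {false ∷ _} ()
enc-injective {[]}        {true ∷ _}  ()
enc-injective {false ∷ _} {[]}        ()
enc-injective {true ∷ _}  {[]}        ()
enc-injective {false ∷ s} {false ∷ t} eq =
  cong (false ∷_) (enc-injective (*-cancelˡ-≡ (enc s) (enc t) 2 (suc-injective eq)))
enc-injective {true ∷ s}  {true ∷ t}  eq =
  cong (true ∷_) (enc-injective (*-cancelˡ-≡ (enc s) (enc t) 2 (suc-injective (suc-injective eq))))
enc-injective {false ∷ s} {true ∷ t}  eq = contradiction (suc-injective eq) (even≢odd (enc s) (enc t))
enc-injective {true ∷ s}  {false ∷ t} eq = contradiction (sym (suc-injective eq)) (even≢odd (enc t) (enc s))

incr : Str → Str
incr []          = false ∷ []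
incr (false ∷ s) = true ∷ s
incr (true ∷ s)  = false ∷ incr s

enc-incr : ∀ s → enc (incr s) ≡ suc (enc s)
enc-incr []          = refl
enc-incr (false ∷ s) = refl
enc-incr (true ∷ s)  = cong suc (trans (cong (2 *_) (enc-incr s)) (*-suc 2 (enc s)))

decode : ℕ → Str
decode zero    = []
decode (suc n) = incr (decode n)

enc-decode : ∀ n → enc (decode n) ≡ n
enc-decode zero    = refl
enc-decode (suc n) = trans (enc-incr (decode n)) (cong suc (enc-decode n))

prog : ℕ → Str → Str
prog e ρ = replicate e false ++ true ∷ ρ

prog-++ : ∀ e ρ δ → prog e ρ ++ δ ≡ prog e (ρ ++ δ)
prog-++ e ρ δ = ++-assoc (replicate e false) (true ∷ ρ) δ

prog-injective : ∀ {e e′ ρ ρ′} → prog e ρ ≡ prog e′ ρ′ → e ≡ e′ × ρ ≡ ρ′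
prog-injective {zero}  {zero}   refl = refl , refl
prog-injective {zero}  {suc _}  ()
prog-injective {suc _} {zero}   ()
prog-injective {suc e} {suc e′} eq with prog-injective {e} {e′} (∷-injectiveʳ eq)
... | refl , ρ≡ρ′ = refl , ρ≡ρ′

ℓ-prog : ∀ {ℓ} → Additive ℓ → ∀ e τ → ℓ (prog e τ) ≡ ℓ τ + ℓ (prog e [])
ℓ-prog {ℓ} additive e τ = begin
  ℓ (prog e τ)        ≡⟨ cong ℓ (sym (prog-++ e [] τ)) ⟩
  ℓ (prog e [] ++ τ)  ≡⟨ additive (prog e []) τ ⟩
  ℓ (prog e []) + ℓ τ ≡⟨ +-comm (ℓ (prog e [])) (ℓ τ) ⟩
  ℓ τ + ℓ (prog e []) ∎
  where open ≡-Reasoning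

progNum : ℕ → ℕ → ℕ
progNum zero    r = suc (suc (2 * r))
progNum (suc e) r = suc (2 * progNum e r)

enc-prog : ∀ e ρ → enc (prog e ρ) ≡ progNum e (enc ρ)
enc-prog zero    ρ = refl
enc-prog (suc e) ρ = cong (suc ∘ (2 *_)) (enc-prog e ρ)

progNumᶜ : Code
progNumᶜ = compᶜ (iterᶜ (compᶜ succᶜ (compᶜ succᶜ doubleᶜ)) (compᶜ succᶜ doubleᶜ)) swapᶜ

eval-progNum : ∀ n → Eval progNumᶜ n (uncurry progNum (unpair n))
eval-progNum n = ev-comp (ev-pair ev-right ev-left)
  (eval-iter (λ r e → progNum e r)
    (λ r → ev-comp (ev-comp (eval-double r) ev-succ) ev-succ)
    (λ r e → ev-comp (eval-double (progNum e r)) ev-succ)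
    (proj₂ (unpair n)) (proj₁ (unpair n)))

matchᶜ : Code
matchᶜ = compᶜ distᶜ (pairᶜ (compᶜ progNumᶜ rightᶜ) leftᶜ)

eval-match : ∀ x n → Eval matchᶜ ⟪ x , n ⟫ (dist (uncurry progNum (unpair n)) x)
eval-match x n =
  ev-comp (ev-pair (ev-comp (eval-right x n) (eval-progNum n)) (eval-left x n)) (eval-dist _ x)

match-root : ∀ {τ n} → Eval matchᶜ ⟪ enc τ , n ⟫ zero → ∃₂ λ e ρ → τ ≡ prog e ρ × n ≡ ⟪ e , enc ρ ⟫
match-root {τ} {n} root
  with unpair n | ⟪⟫-unpair n | dist≡0⇒≡ {uncurry progNum (unpair n)} {enc τ} (Eval-deterministic (eval-match (enc τ) n) root)
... | e , r | refl | progNum≡enc =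
  e , decode r , enc-injective enc-τ≡enc-prog , cong ⟪ e ,_⟫ (sym (enc-decode r))
  where
  enc-τ≡enc-prog : enc τ ≡ enc (prog e (decode r))
  enc-τ≡enc-prog = begin
    enc τ                      ≡⟨ sym progNum≡enc ⟩
    progNum e r                ≡⟨ cong (progNum e) (sym (enc-decode r)) ⟩
    progNum e (enc (decode r)) ≡⟨ sym (enc-prog e (decode r)) ⟩
    enc (prog e (decode r))    ∎
    where open ≡-Reasoning

parseᶜ : Code
parseᶜ = rfindᶜ matchᶜ

parse-sound : ∀ {τ n} → Eval parseᶜ (enc τ) n → ∃₂ λ e ρ → τ ≡ prog e ρ × n ≡ ⟪ e , enc ρ ⟫
parse-sound (ev-rfind search) = match-root (Search⇒root search)

parse-complete : ∀ e ρ → Eval parseᶜ (enc (prog e ρ)) ⟪ e , enc ρ ⟫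
parse-complete e ρ with search-terminates ⟪ e , enc ρ ⟫ (λ n → _ , eval-match (enc (prog e ρ)) n) root
  where
  root : Eval matchᶜ ⟪ enc (prog e ρ) , ⟪ e , enc ρ ⟫ ⟫ zero
  root = subst (Eval matchᶜ _)
    (≡⇒dist≡0 (trans (cong (uncurry progNum) (unpair-⟪⟫ e (enc ρ))) (sym (enc-prog e ρ))))
    (eval-match (enc (prog e ρ)) ⟪ e , enc ρ ⟫)
... | r , search with match-root {prog e ρ} {r} (Search⇒root search)
...   | _ , _ , prog≡prog , refl with prog-injective prog≡prog
...     | refl , refl = ev-rfind search

URun-prefixFree : ∀ {M} → PFListing M → ∀ {τ₁ τ₂ σ₁ σ₂} → URun M τ₁ σ₁ → URun M τ₂ σ₂ → ¬ τ₁ ⊏ τ₂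
URun-prefixFree L (e , ρ₁ , refl , run₁) (_ , ρ₂ , refl , run₂) ((δ , extends) , τ₁≢τ₂)
  with prog-injective (trans (sym (prog-++ e ρ₁ δ)) extends)
... | refl , ρ₁δ≡ρ₂ =
  PFListing.allPF L e ρ₁ ρ₂ _ _ run₁ run₂ ((δ , ρ₁δ≡ρ₂) , τ₁≢τ₂ ∘ cong (prog e))

module _ {M : ℕ → Code} (L : PFListing M) {h : Str → Str} {hᶜ : Code}
         (h-computed : ∀ σ → Run hᶜ σ (h σ)) where
  open PFListing L

  h∘Uᶜ : Code
  h∘Uᶜ = compᶜ hᶜ (compᶜ (proj₁ uniform) parseᶜ)

  URun⇒Run-h∘U : ∀ {τ σ} → URun M τ σ → Run h∘Uᶜ τ (h σ)
  URun⇒Run-h∘U (e , ρ , refl , run) =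
    ev-comp (ev-comp (parse-complete e ρ) (proj₂ (proj₂ uniform e ρ _) run)) (h-computed _)

  Run-h∘U⇒URun : ∀ {τ y} → Run h∘Uᶜ τ y → ∃[ σ ] URun M τ σ × y ≡ h σ
  Run-h∘U⇒URun (ev-comp {y = z} (ev-comp parsed simulated) h-applied) with parse-sound parsed
  ... | e , ρ , refl , refl =
    decode z , (e , ρ , refl , run) , enc-injective (Eval-deterministic h-applied h-on-z)
    where
    run : Run (M e) ρ (decode z)
    run = proj₁ (proj₂ uniform e ρ (decode z))
      (subst (Eval (proj₁ uniform) ⟪ e , enc ρ ⟫) (sym (enc-decode z)) simulated)

    h-on-z : Eval hᶜ z (enc (h (decode z)))
    h-on-z = subst (λ x → Eval hᶜ x (enc (h (decode z)))) (enc-decode z) (h-computed (decode z))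

  h∘U-prefixFree : PrefixFree h∘Uᶜ
  h∘U-prefixFree _ _ _ _ run₁ run₂ =
    URun-prefixFree L (proj₁ (proj₂ (Run-h∘U⇒URun run₁))) (proj₁ (proj₂ (Run-h∘U⇒URun run₂)))

  h∘U-in-listing : ∃[ e ] (∀ {τ σ} → URun M τ σ → URun M (prog e τ) (h σ))
  h∘U-in-listing with complete h∘Uᶜ h∘U-prefixFree
  ... | e , same-runs = e , λ {τ} Uτ≡σ → e , τ , refl , proj₂ (same-runs τ _) (URun⇒Run-h∘U Uτ≡σ)

mainTheorem12 : (M : ℕ → Code) → PFListing M →
    (ℓ : Str → ℕ) → GenLength ℓ → Additive ℓ →
    (h : Str → Str) → ComputableStr h →
    ∃[ c ] (∀ σ m n → IsK M ℓ (h σ) m → IsK M ℓ σ n → m ≤ n + c)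
mainTheorem12 M L ℓ _ additive h (hᶜ , h-computed) with h∘U-in-listing L h-computed
... | e , h∘U-at-e = ℓ (prog e []) , bound
  where
  bound : ∀ σ m n → IsK M ℓ (h σ) m → IsK M ℓ σ n → m ≤ n + ℓ (prog e [])
  bound σ m n (_ , m-minimal) ((τ , Uτ≡σ , refl) , _) =
    subst (m ≤_) (ℓ-prog {ℓ} additive e τ) (m-minimal (prog e τ) (h∘U-at-e Uτ≡σ))
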